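{- For every $n\in\mathbb{Z}^+$, $\mathsf{LP_n}\neq\mathsf{V}(\mathbf{F}_n(\mathbb{Z}))$.
   Context: An $\ell$-pregroup is an algebra $(A,\wedge,\vee,\cdot,{}^{\ell},{}^{r},1)$ with lattice reduct, monoid reduct, order-preserving multiplication, and $x^{\ell}x\le 1\le xx^{\ell}$, $xx^{r}\le 1\le x^{r}x$. $\mathsf{LP_n}$ is the variety of $n$-periodic $\ell$-pregroups (satisfying $x^{\ell^n}=x^{r^n}$). $\mathbf{F}(\mathbb{Z})$ is the $\ell$-pregroup of maps on $\mathbb{Z}$ with residuals ($f^r(b)=\max\{a:f(a)\le b\}$) and dual residuals ($f^\ell(a)=\min\{b:a\le f(b)\}$) of all orders, under composition, identity, pointwise order, ${}^\ell,{}^r$; $\mathbf{F}_n(\mathbb{Z})$ is its subalgebra of $f$ with $f^{\ell^n}=f^{r^n}$. $\mathsf{V}(\mathbf{A})$ is the variety generated by $\mathbf{A}$. -}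

module Defs where

open import Level using (0ℓ)
open import Data.Nat using (ℕ; zero; suc)
open import Data.Bool using (Bool; true; false; not; if_then_else_)
open import Data.Integer using (ℤ; +_; -[1+_]; _⊓_; _⊔_; _≤_; -_; _+_; _-_)
open import Data.Product using (Σ; _×_; proj₁)
open import Function using (_∘_; id)
open import Function.Bundles using (_⇔_)
open import Relation.Binary using (Rel; IsEquivalence)
open import Relation.Binary.PropositionalEquality using (_≡_)
open import Algebra.Core using (Op₁; Op₂)
open import Algebra.Structures using (IsMonoid)
open import Algebra.Lattice.Structures using (IsLattice)

data Term : Set where
  var  : ℕ → Term
  meet : Term → Term → Term
  join : Term → Term → Term
  mul  : Term → Term → Term
  lft  : Term → Term
  rgt  : Term → Term
  one  : Term

record Alg : Set₁ where
  field
    Carrier : Set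
    _≈_     : Rel Carrier 0ℓ
    isEquivalence : IsEquivalence _≈_
    _∧_ _∨_ _·_ : Op₂ Carrier
    ˡ ʳ     : Op₁ Carrier
    e       : Carrier
    ∧-cong  : ∀ {x y u v} → x ≈ y → u ≈ v → (x ∧ u) ≈ (y ∧ v)
    ∨-cong  : ∀ {x y u v} → x ≈ y → u ≈ v → (x ∨ u) ≈ (y ∨ v)
    ·-cong  : ∀ {x y u v} → x ≈ y → u ≈ v → (x · u) ≈ (y · v)
    ˡ-cong  : ∀ {x y} → x ≈ y → ˡ x ≈ ˡ y
    ʳ-cong  : ∀ {x y} → x ≈ y → ʳ x ≈ ʳ y

  _≤ᴬ_ : Rel Carrier 0ℓ
  x ≤ᴬ y = (x ∧ y) ≈ x

  ⟦_⟧ : Term → (ℕ → Carrier) → Carrier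
  ⟦ var i ⟧    v = v i
  ⟦ meet s t ⟧ v = ⟦ s ⟧ v ∧ ⟦ t ⟧ v
  ⟦ join s t ⟧ v = ⟦ s ⟧ v ∨ ⟦ t ⟧ v
  ⟦ mul s t ⟧  v = ⟦ s ⟧ v · ⟦ t ⟧ v
  ⟦ lft s ⟧    v = ˡ (⟦ s ⟧ v)
  ⟦ rgt s ⟧    v = ʳ (⟦ s ⟧ v)
  ⟦ one ⟧      v = e

Satisfies : Alg → Term → Term → Set
Satisfies A s t = ∀ (v : ℕ → Alg.Carrier A) → Alg._≈_ A (Alg.⟦_⟧ A s v) (Alg.⟦_⟧ A t v)

iter : {X : Set} → ℕ → (X → X) → X → X
iter zero    f x = x
iter (suc k) f x = f (iter k f x)

record IsLPregroup (A : Alg) : Set where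
  open Alg A
  field
    isLattice : IsLattice _≈_ _∨_ _∧_
    isMonoid  : IsMonoid _≈_ _·_ e
    ·-monoˡ   : ∀ {x y} z → x ≤ᴬ y → (z · x) ≤ᴬ (z · y)
    ·-monoʳ   : ∀ {x y} z → x ≤ᴬ y → (x · z) ≤ᴬ (y · z)
    ˡ-contr   : ∀ x → (ˡ x · x) ≤ᴬ e
    ˡ-exp     : ∀ x → e ≤ᴬ (x · ˡ x)
    ʳ-contr   : ∀ x → (x · ʳ x) ≤ᴬ e
    ʳ-exp     : ∀ x → e ≤ᴬ (ʳ x · x)

InLP : ℕ → Alg → Set
InLP n A = IsLPregroup A × (∀ x → Alg._≈_ A (iter n (Alg.ˡ A) x) (iter n (Alg.ʳ A) x))

-- An element f of F(ℤ) is encoded by the (unique) ℤ-indexed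
-- sequence of its iterated residuals / dual residuals:
--   s 0 = f,  s (k+1) = (s k)ʳ,  s (k-1) = (s k)ˡ,
-- where "g is the residual of h" means  h a ≤ b ⇔ a ≤ g b  for all a, b
-- (equivalently g b = max{a : h a ≤ b}, h a = min{b : a ≤ g b}).

Seq : Set
Seq = ℤ → ℤ → ℤ

IsResSeq : Seq → Set
IsResSeq s = ∀ k a b → (s k a ≤ b) ⇔ (a ≤ s (k + + 1) b)

Fn-Elem : ℕ → Set
Fn-Elem n = Σ Seq λ s → IsResSeq s × (∀ a → s (- (+ n)) a ≡ s (+ n) a)

evenℕ : ℕ → Bool
evenℕ zero    = true
evenℕ (suc n) = not (evenℕ n)

evenℤ : ℤ → Bool
evenℤ (+ n)    = evenℕ n
evenℤ -[1+ n ] = not (evenℕ n)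

-- operations of F(ℤ) on residual sequences:
--  (fg)ʳ = gʳfʳ, (f∧g)ʳ = fʳ∨gʳ, (f∨g)ʳ = fʳ∧gʳ (and dually for ˡ)
mulS : Seq → Seq → Seq
mulS s t k = if evenℤ k then s k ∘ t k else t k ∘ s k

meetS : Seq → Seq → Seq
meetS s t k a = if evenℤ k then s k a ⊓ t k a else s k a ⊔ t k a

joinS : Seq → Seq → Seq
joinS s t k a = if evenℤ k then s k a ⊔ t k a else s k a ⊓ t k a

lftS : Seq → Seq
lftS s k = s (k - + 1)

rgtS : Seq → Seq
rgtS s k = s (k + + 1)

oneS : Seq
oneS k = id

evalS : {n : ℕ} → Term → (ℕ → Fn-Elem n) → Seq
evalS (var i)    v = proj₁ (v i)
evalS (meet s t) v = meetS (evalS s v) (evalS t v)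
evalS (join s t) v = joinS (evalS s v) (evalS t v)
evalS (mul s t)  v = mulS (evalS s v) (evalS t v)
evalS (lft s)    v = lftS (evalS s v)
evalS (rgt s)    v = rgtS (evalS s v)
evalS one        v = oneS

SatisfiesFn : ℕ → Term → Term → Set
SatisfiesFn n s t = ∀ (v : ℕ → Fn-Elem n) (a : ℤ) → evalS s v (+ 0) a ≡ evalS t v (+ 0) a

-- membership in V(F_n(ℤ)) = Mod(Eq(F_n(ℤ))) (Birkhoff's HSP theorem)
InV : ℕ → Alg → Set
InV n A = ∀ s t → SatisfiesFn n s t → Satisfies A s t

{-# OPTIONS --safe #-}
-- For f ∈ F(ℤ) one has f^{ℓℓ}(c + 1) = f(c) + 1.  If f ∈ Fₙ(ℤ) then also
-- f^{ℓ²ⁿ} = f, so u(f) = f ∨ f^{ℓℓ} ∨ … ∨ f^{ℓ^{2(n-1)}} satisfies u(f)(c + 1) = u(f)(c) + 1,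
-- i.e. u(f) is a translation of ℤ.  Translations commute, so Fₙ(ℤ) satisfies
-- u(x)·u(y) = u(y)·u(x).  In an ℓ-group xˡ = xʳ = x⁻¹, so u(x) = x and the
-- identity becomes commutativity; the discrete Heisenberg group, ordered
-- lexicographically, is an n-periodic ℓ-pregroup that violates it.
module Submission where

open import Defs
open import Data.Nat using (ℕ; zero; suc)
open import Data.Product using (_×_; _,_; proj₁)
open import Function using (_∘_)
open import Function.Bundles using (_⇔_; Equivalence)
open import Relation.Binary.PropositionalEquality
  using (_≡_; _≢_; _≗_; refl; sym; trans; cong; cong₂; subst; module ≡-Reasoning)
open import Relation.Binary.Structures using (IsEquivalence)
open import Relation.Nullary using (¬_)

lft²^ : ℕ → Term → Term
lft²^ j = iter j (lft ∘ lft)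

⋁lft² : ℕ → Term → Term
⋁lft² zero    t = t
⋁lft² (suc m) t = join (⋁lft² m t) (lft²^ (suc m) t)

⋁lft²-product : ℕ → ℕ → ℕ → Term
⋁lft²-product m i j = mul (⋁lft² m (var i)) (⋁lft² m (var j))

module _ (A : Alg) where

  open Alg A
  open IsEquivalence isEquivalence using () renaming (refl to ≈-refl; trans to ≈-trans)

  ⟦lft²^⟧ : (∀ x → ˡ (ˡ x) ≈ x) → ∀ j t v → ⟦ lft²^ j t ⟧ v ≈ ⟦ t ⟧ v
  ⟦lft²^⟧ ˡˡ≈id zero    t v = ≈-refl
  ⟦lft²^⟧ ˡˡ≈id (suc j) t v = ≈-trans (ˡˡ≈id _) (⟦lft²^⟧ ˡˡ≈id j t v)

  ⟦⋁lft²⟧ : (∀ x → ˡ (ˡ x) ≈ x) → (∀ x → (x ∨ x) ≈ x) → ∀ m t v → ⟦ ⋁lft² m t ⟧ v ≈ ⟦ t ⟧ v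
  ⟦⋁lft²⟧ ˡˡ≈id ∨-idem zero    t v = ≈-refl
  ⟦⋁lft²⟧ ˡˡ≈id ∨-idem (suc m) t v =
    ≈-trans (∨-cong (⟦⋁lft²⟧ ˡˡ≈id ∨-idem m t v) (⟦lft²^⟧ ˡˡ≈id (suc m) t v)) (∨-idem _)

module Fₙ-Identity where

  open import Data.Integer
    using (ℤ; +_; -[1+_]; 0ℤ; 1ℤ; -1ℤ; -_; _+_; _-_; _⊔_; _≤_; _≰_)
    renaming (suc to sucℤ; pred to predℤ)
  open import Data.Integer.Properties
  open import Data.Integer.Tactic.RingSolver using (solve-∀)
  open Equivalence using (to; from)

  CommutesWithSuc : (ℤ → ℤ) → Set
  CommutesWithSuc f = ∀ c → f (sucℤ c) ≡ sucℤ (f c)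

  suc-distrib-⊔ : ∀ i j → sucℤ (i ⊔ j) ≡ sucℤ i ⊔ sucℤ j
  suc-distrib-⊔ = mono-<-distrib-⊔ sucℤ (+-monoʳ-< 1ℤ)

  commutesWithSuc⇒translation : ∀ f → CommutesWithSuc f → ∀ c → f c ≡ f 0ℤ + c
  commutesWithSuc⇒translation f f-suc = go
    where
    f-pred : ∀ c → f (predℤ c) ≡ predℤ (f c)
    f-pred c = begin
      f (predℤ c)                ≡⟨ pred-suc _ ⟨
      predℤ (sucℤ (f (predℤ c))) ≡⟨ cong predℤ (f-suc (predℤ c)) ⟨
      predℤ (f (sucℤ (predℤ c))) ≡⟨ cong (predℤ ∘ f) (suc-pred c) ⟩
      predℤ (f c)                ∎
      where open ≡-Reasoning
    shift-+ : ∀ (d a b : ℤ) → d + (a + b) ≡ a + (d + b)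
    shift-+ = solve-∀
    go : ∀ c → f c ≡ f 0ℤ + c
    go (+ zero)     = sym (+-identityʳ (f 0ℤ))
    go (+ suc k)    = trans (f-suc (+ k))
                        (trans (cong sucℤ (go (+ k))) (shift-+ 1ℤ (f 0ℤ) (+ k)))
    go -[1+ zero ]  = trans (f-pred 0ℤ) (+-comm -1ℤ (f 0ℤ))
    go -[1+ suc k ] = trans (f-pred -[1+ k ])
                        (trans (cong predℤ (go -[1+ k ])) (shift-+ -1ℤ (f 0ℤ) -[1+ k ]))

  commutesWithSuc-comm : ∀ f g → CommutesWithSuc f → CommutesWithSuc g → ∀ a → f (g a) ≡ g (f a)
  commutesWithSuc-comm f g f-suc g-suc a = begin
    f (g a)               ≡⟨ commutesWithSuc⇒translation f f-suc (g a) ⟩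
    f 0ℤ + g a            ≡⟨ cong (_+_ (f 0ℤ)) (commutesWithSuc⇒translation g g-suc a) ⟩
    f 0ℤ + (g 0ℤ + a)     ≡⟨ exchange (f 0ℤ) (g 0ℤ) a ⟩
    g 0ℤ + (f 0ℤ + a)     ≡⟨ cong (_+_ (g 0ℤ)) (commutesWithSuc⇒translation f f-suc a) ⟨
    g 0ℤ + f a            ≡⟨ commutesWithSuc⇒translation g g-suc (f a) ⟨
    g (f a)               ∎
    where
    open ≡-Reasoning
    exchange : ∀ (x y z : ℤ) → x + (y + z) ≡ y + (x + z)
    exchange = solve-∀

  maxUpTo : (ℕ → ℤ → ℤ) → ℕ → ℤ → ℤ
  maxUpTo g zero    c = g 0 c
  maxUpTo g (suc m) c = maxUpTo g m c ⊔ g (suc m) c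

  module _ {g : ℕ → ℤ → ℤ} (g-suc : ∀ j c → g (suc j) (sucℤ c) ≡ sucℤ (g j c)) where

    maxUpTo-suc : ∀ m c → maxUpTo g (suc m) (sucℤ c) ≡ g 0 (sucℤ c) ⊔ sucℤ (maxUpTo g m c)
    maxUpTo-suc zero    c = cong (g 0 (sucℤ c) ⊔_) (g-suc 0 c)
    maxUpTo-suc (suc m) c = begin
      maxUpTo g (suc m) (sucℤ c) ⊔ g (suc (suc m)) (sucℤ c)
        ≡⟨ cong₂ _⊔_ (maxUpTo-suc m c) (g-suc (suc m) c) ⟩
      (g 0 (sucℤ c) ⊔ sucℤ (maxUpTo g m c)) ⊔ sucℤ (g (suc m) c)
        ≡⟨ ⊔-assoc _ _ _ ⟩
      g 0 (sucℤ c) ⊔ (sucℤ (maxUpTo g m c) ⊔ sucℤ (g (suc m) c))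
        ≡⟨ cong (g 0 (sucℤ c) ⊔_) (suc-distrib-⊔ (maxUpTo g m c) (g (suc m) c)) ⟨
      g 0 (sucℤ c) ⊔ sucℤ (maxUpTo g (suc m) c) ∎
      where open ≡-Reasoning

    -- g (suc m) = g 0 makes the shift g j ↦ g (suc j) a rotation of {g 0, …, g m}.
    maxUpTo-commutesWithSuc : ∀ m → g (suc m) ≗ g 0 → CommutesWithSuc (maxUpTo g m)
    maxUpTo-commutesWithSuc zero    period c = trans (sym (period (sucℤ c))) (g-suc 0 c)
    maxUpTo-commutesWithSuc (suc m) period c = begin
      maxUpTo g (suc m) (sucℤ c)                 ≡⟨ maxUpTo-suc m c ⟩
      g 0 (sucℤ c) ⊔ sucℤ (maxUpTo g m c)        ≡⟨ cong (_⊔ sucℤ (maxUpTo g m c)) g0-suc ⟩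
      sucℤ (g (suc m) c) ⊔ sucℤ (maxUpTo g m c)  ≡⟨ ⊔-comm _ _ ⟩
      sucℤ (maxUpTo g m c) ⊔ sucℤ (g (suc m) c)  ≡⟨ suc-distrib-⊔ (maxUpTo g m c) (g (suc m) c) ⟨
      sucℤ (maxUpTo g (suc m) c)                 ∎
      where
      open ≡-Reasoning
      g0-suc : g 0 (sucℤ c) ≡ sucℤ (g (suc m) c)
      g0-suc = trans (sym (period (sucℤ c))) (g-suc (suc m) c)

  module _ {s : Seq} (res : IsResSeq s) where

    resSeq-unique : ∀ j k → s (j + 1ℤ) ≗ s (k + 1ℤ) → s j ≗ s k
    resSeq-unique j k eq a = ≤-antisym (below j k eq) (below k j (sym ∘ eq))
      where
      below : ∀ j k → s (j + 1ℤ) ≗ s (k + 1ℤ) → s j a ≤ s k a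
      below j k eq =
        from (res j a (s k a)) (subst (a ≤_) (sym (eq _)) (to (res k a (s k a)) ≤-refl))

    resSeq-descend : ∀ {j k} → s j ≗ s k → ∀ i → s (j - + i) ≗ s (k - + i)
    resSeq-descend {j} {k} eq zero a = begin
      s (j - + 0) a  ≡⟨ cong (λ l → s l a) (+-identityʳ j) ⟩
      s j a          ≡⟨ eq a ⟩
      s k a          ≡⟨ cong (λ l → s l a) (+-identityʳ k) ⟨
      s (k - + 0) a  ∎
      where open ≡-Reasoning
    resSeq-descend {j} {k} eq (suc i) = resSeq-unique (j - + suc i) (k - + suc i) λ b → begin
      s (j - + suc i + 1ℤ) b  ≡⟨ cong (λ l → s l b) (sub-suc-add-1 j (+ i)) ⟩
      s (j - + i) b           ≡⟨ resSeq-descend eq i b ⟩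
      s (k - + i) b           ≡⟨ cong (λ l → s l b) (sub-suc-add-1 k (+ i)) ⟨
      s (k - + suc i + 1ℤ) b  ∎
      where
      open ≡-Reasoning
      sub-suc-add-1 : ∀ x y → x - (1ℤ + y) + 1ℤ ≡ x - y
      sub-suc-add-1 = solve-∀

    resSeq-suc : ∀ k c → s k (sucℤ c) ≡ sucℤ (s (k + 1ℤ + 1ℤ) c)
    resSeq-suc k c = ≤-antisym upper lower
      where
      suc≰ : ∀ {i} → sucℤ i ≰ i
      suc≰ si≤i = <-irrefl refl (suc[i]≤j⇒i<j si≤i)
      h : ℤ
      h = s (k + 1ℤ + 1ℤ) c
      upper : s k (sucℤ c) ≤ sucℤ h
      upper = from (res k _ _) (i<j⇒suc[i]≤j (≰⇒> λ ≤c → suc≰ (to (res (k + 1ℤ) _ _) ≤c)))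
      lower : sucℤ h ≤ s k (sucℤ c)
      lower = i<j⇒suc[i]≤j (≰⇒> λ ≤h →
        suc≰ (≤-trans (to (res k _ _) ≤h) (from (res (k + 1ℤ) _ _) ≤-refl)))

  -- f^{ℓ^{2j}} for f = s 0ℤ, indexed in the form evalS-lft²^ produces at 0ℤ.
  lft²^-map : Seq → ℕ → ℤ → ℤ
  lft²^-map s j = s (0ℤ - + j - + j)

  lft²^-map-suc : ∀ {s} → IsResSeq s → ∀ j c → lft²^-map s (suc j) (sucℤ c) ≡ sucℤ (lft²^-map s j c)
  lft²^-map-suc {s} res j c = trans (resSeq-suc res (0ℤ - + suc j - + suc j) c)
                                    (cong (λ k → sucℤ (s k c)) (add-2-sub-suc² 0ℤ (+ j)))
    where
    add-2-sub-suc² : ∀ x y → x - (1ℤ + y) - (1ℤ + y) + 1ℤ + 1ℤ ≡ x - y - y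
    add-2-sub-suc² = solve-∀

  -- f^{ℓⁿ} = f^{rⁿ} gives f^{ℓ²ⁿ} = f by applying ˡ n more times on both sides.
  Fₙ-period : ∀ {n} (x : Fn-Elem n) → lft²^-map (proj₁ x) n ≗ proj₁ x 0ℤ
  Fₙ-period {n} (s , res , ℓⁿ≡rⁿ) a = begin
    s (0ℤ - + n - + n) a  ≡⟨ cong (λ k → s (k - + n) a) (+-identityˡ (- (+ n))) ⟩
    s (- (+ n) - + n) a   ≡⟨ resSeq-descend res ℓⁿ≡rⁿ n a ⟩
    s (+ n - + n) a       ≡⟨ cong (λ k → s k a) (+-inverseʳ (+ n)) ⟩
    s 0ℤ a                ∎
    where open ≡-Reasoning

  evalS-lft²^ : ∀ {n} j t (v : ℕ → Fn-Elem n) i → evalS (lft²^ j t) v i ≡ evalS t v (i - + j - + j)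
  evalS-lft²^ zero    t v i = cong (evalS t v) (sym (trans (+-identityʳ (i - + 0)) (+-identityʳ i)))
  evalS-lft²^ (suc j) t v i = trans (evalS-lft²^ j t v (i - 1ℤ - 1ℤ))
                                    (cong (evalS t v) (sub-2-sub² i (+ j)))
    where
    sub-2-sub² : ∀ x y → x - 1ℤ - 1ℤ - y - y ≡ x - (1ℤ + y) - (1ℤ + y)
    sub-2-sub² = solve-∀

  evalS-⋁lft² : ∀ {n} m t (v : ℕ → Fn-Elem n) →
                evalS (⋁lft² m t) v 0ℤ ≗ maxUpTo (lft²^-map (evalS t v)) m
  evalS-⋁lft² zero    t v a = refl
  evalS-⋁lft² (suc m) t v a =
    cong₂ _⊔_ (evalS-⋁lft² m t v a) (cong (λ f → f a) (evalS-lft²^ (suc m) t v 0ℤ))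

  ⋁lft²-commutesWithSuc : ∀ m (x : Fn-Elem (suc m)) →
                          CommutesWithSuc (maxUpTo (lft²^-map (proj₁ x)) m)
  ⋁lft²-commutesWithSuc m x@(_ , res , _) =
    maxUpTo-commutesWithSuc (lft²^-map-suc res) m (Fₙ-period x)

  Fₙ⊨⋁lft²-comm : ∀ m → SatisfiesFn (suc m) (⋁lft²-product m 0 1) (⋁lft²-product m 1 0)
  Fₙ⊨⋁lft²-comm m v a = begin
    evalS (⋁lft² m (var 0)) v 0ℤ (evalS (⋁lft² m (var 1)) v 0ℤ a)  ≡⟨ eval-u∘u 0 1 ⟩
    u 0 (u 1 a)                                                     ≡⟨ u-comm ⟩
    u 1 (u 0 a)                                                     ≡⟨ eval-u∘u 1 0 ⟨
    evalS (⋁lft² m (var 1)) v 0ℤ (evalS (⋁lft² m (var 0)) v 0ℤ a)  ∎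
    where
    open ≡-Reasoning
    u : ℕ → ℤ → ℤ
    u i = maxUpTo (lft²^-map (proj₁ (v i))) m
    u-comm : u 0 (u 1 a) ≡ u 1 (u 0 a)
    u-comm = commutesWithSuc-comm (u 0) (u 1)
      (⋁lft²-commutesWithSuc m (v 0)) (⋁lft²-commutesWithSuc m (v 1)) a
    eval-u∘u : ∀ i j → evalS (⋁lft² m (var i)) v 0ℤ (evalS (⋁lft² m (var j)) v 0ℤ a) ≡ u i (u j a)
    eval-u∘u i j = trans (evalS-⋁lft² m (var i) v _) (cong (u i) (evalS-⋁lft² m (var j) v a))

-- (a , b , c) stands for the matrix [[1, a, c], [0, 1, b], [0, 0, 1]].
module Heisenberg where

  open import Data.Integer using (ℤ; +_; 0ℤ; 1ℤ; -_; _+_; _*_; _<_; _≤_)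
  open import Data.Integer.Properties
    using ( ≤-refl; ≤-trans; ≤-antisym; ≤-total; <-trans; <-asym; <-irrefl; <-cmp
          ; +-assoc; +-identityˡ; +-identityʳ; +-inverseˡ; +-inverseʳ; neg-involutive
          ; +-monoˡ-<; +-monoʳ-<; +-monoˡ-≤; +-monoʳ-≤ )
  open import Data.Integer.Tactic.RingSolver using (solve-∀)
  open import Data.Empty using (⊥-elim)
  open import Data.Sum using (inj₁; inj₂)
  open import Relation.Binary.Bundles using (TotalOrder)
  open import Relation.Binary.Definitions using (Total; tri<; tri≈; tri>)
  open import Relation.Binary.PropositionalEquality using (isEquivalence)

  Heis : Set
  Heis = ℤ × ℤ × ℤ

  infix 4 _⊑_
  data _⊑_ : Heis → Heis → Set where
    <₁ : ∀ {a b c a′ b′ c′} → a < a′ → (a , b , c) ⊑ (a′ , b′ , c′)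
    <₂ : ∀ {a b c b′ c′} → b < b′ → (a , b , c) ⊑ (a , b′ , c′)
    ≤₃ : ∀ {a b c c′} → c ≤ c′ → (a , b , c) ⊑ (a , b , c′)

  ⊑-refl : ∀ {x} → x ⊑ x
  ⊑-refl = ≤₃ ≤-refl

  ⊑-trans : ∀ {x y z} → x ⊑ y → y ⊑ z → x ⊑ z
  ⊑-trans (<₁ p) (<₁ q) = <₁ (<-trans p q)
  ⊑-trans (<₁ p) (<₂ _) = <₁ p
  ⊑-trans (<₁ p) (≤₃ _) = <₁ p
  ⊑-trans (<₂ _) (<₁ q) = <₁ q
  ⊑-trans (<₂ p) (<₂ q) = <₂ (<-trans p q)
  ⊑-trans (<₂ p) (≤₃ _) = <₂ p
  ⊑-trans (≤₃ _) (<₁ q) = <₁ q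
  ⊑-trans (≤₃ _) (<₂ q) = <₂ q
  ⊑-trans (≤₃ p) (≤₃ q) = ≤₃ (≤-trans p q)

  ⊑-antisym : ∀ {x y} → x ⊑ y → y ⊑ x → x ≡ y
  ⊑-antisym (<₁ p) (<₁ q) = ⊥-elim (<-asym p q)
  ⊑-antisym (<₁ p) (<₂ _) = ⊥-elim (<-irrefl refl p)
  ⊑-antisym (<₁ p) (≤₃ _) = ⊥-elim (<-irrefl refl p)
  ⊑-antisym (<₂ _) (<₁ q) = ⊥-elim (<-irrefl refl q)
  ⊑-antisym (<₂ p) (<₂ q) = ⊥-elim (<-asym p q)
  ⊑-antisym (<₂ p) (≤₃ _) = ⊥-elim (<-irrefl refl p)
  ⊑-antisym (≤₃ _) (<₁ q) = ⊥-elim (<-irrefl refl q)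
  ⊑-antisym (≤₃ _) (<₂ q) = ⊥-elim (<-irrefl refl q)
  ⊑-antisym (≤₃ p) (≤₃ q) = cong (λ c → _ , _ , c) (≤-antisym p q)

  ⊑-total : Total _⊑_
  ⊑-total (a , b , c) (a′ , b′ , c′) with <-cmp a a′
  ... | tri< a<a′ _ _ = inj₁ (<₁ a<a′)
  ... | tri> _ _ a′<a = inj₂ (<₁ a′<a)
  ... | tri≈ _ refl _ with <-cmp b b′
  ...   | tri< b<b′ _ _ = inj₁ (<₂ b<b′)
  ...   | tri> _ _ b′<b = inj₂ (<₂ b′<b)
  ...   | tri≈ _ refl _ with ≤-total c c′
  ...     | inj₁ c≤c′ = inj₁ (≤₃ c≤c′)
  ...     | inj₂ c′≤c = inj₂ (≤₃ c′≤c)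

  ⊑-totalOrder : TotalOrder _ _ _
  ⊑-totalOrder = record
    { Carrier = Heis ; _≈_ = _≡_ ; _≤_ = _⊑_
    ; isTotalOrder = record
      { isPartialOrder = record
        { isPreorder = record
          { isEquivalence = isEquivalence
          ; reflexive     = λ { refl → ⊑-refl }
          ; trans         = ⊑-trans }
        ; antisym = ⊑-antisym }
      ; total = ⊑-total } }

  open import Algebra.Construct.NaturalChoice.Min ⊑-totalOrder
    using (_⊓_; minOperator; x≤y⇒x⊓y≈x; x⊓y≈x⇒x≤y)
  open import Algebra.Construct.NaturalChoice.Max ⊑-totalOrder
    using (_⊔_; maxOperator; ⊔-idem)
  open import Algebra.Lattice.Construct.NaturalChoice.MinMaxOp minOperator maxOperator
    using (⊔-⊓-isLattice)

  infixl 7 _·_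
  _·_ : Heis → Heis → Heis
  (a , b , c) · (a′ , b′ , c′) = (a + a′ , b + b′ , c + c′ + a * b′)

  _⁻¹ : Heis → Heis
  (a , b , c) ⁻¹ = (- a , - b , - c + a * b)

  ε : Heis
  ε = (0ℤ , 0ℤ , 0ℤ)

  ·-assoc : ∀ x y z → (x · y) · z ≡ x · (y · z)
  ·-assoc (a , b , c) (a′ , b′ , c′) (a″ , b″ , c″) =
    cong₂ _,_ (+-assoc a a′ a″) (cong₂ _,_ (+-assoc b b′ b″) (third a a′ b′ b″ c c′ c″))
    where
    third : ∀ a a′ b′ b″ c c′ c″ →
            c + c′ + a * b′ + c″ + (a + a′) * b″ ≡ c + (c′ + c″ + a′ * b″) + a * (b′ + b″)
    third = solve-∀

  ·-identityˡ : ∀ x → ε · x ≡ x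
  ·-identityˡ (a , b , c) = cong₂ _,_ (+-identityˡ a) (cong₂ _,_ (+-identityˡ b) (third b c))
    where
    third : ∀ b c → 0ℤ + c + 0ℤ * b ≡ c
    third = solve-∀

  ·-identityʳ : ∀ x → x · ε ≡ x
  ·-identityʳ (a , b , c) = cong₂ _,_ (+-identityʳ a) (cong₂ _,_ (+-identityʳ b) (third a c))
    where
    third : ∀ a c → c + 0ℤ + a * 0ℤ ≡ c
    third = solve-∀

  ·-inverseˡ : ∀ x → x ⁻¹ · x ≡ ε
  ·-inverseˡ (a , b , c) = cong₂ _,_ (+-inverseˡ a) (cong₂ _,_ (+-inverseˡ b) (third a b c))
    where
    third : ∀ a b c → - c + a * b + c + - a * b ≡ 0ℤ
    third = solve-∀

  ·-inverseʳ : ∀ x → x · x ⁻¹ ≡ ε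
  ·-inverseʳ (a , b , c) = cong₂ _,_ (+-inverseʳ a) (cong₂ _,_ (+-inverseʳ b) (third a b c))
    where
    third : ∀ a b c → c + (- c + a * b) + a * - b ≡ 0ℤ
    third = solve-∀

  ⁻¹-involutive : ∀ x → (x ⁻¹) ⁻¹ ≡ x
  ⁻¹-involutive (a , b , c) =
    cong₂ _,_ (neg-involutive a) (cong₂ _,_ (neg-involutive b) (third a b c))
    where
    third : ∀ a b c → - (- c + a * b) + - a * - b ≡ c
    third = solve-∀

  ·-monoˡ-⊑ : ∀ z {x y} → x ⊑ y → z · x ⊑ z · y
  ·-monoˡ-⊑ (p , q , r) (<₁ a<a′) = <₁ (+-monoʳ-< p a<a′)
  ·-monoˡ-⊑ (p , q , r) (<₂ b<b′) = <₂ (+-monoʳ-< q b<b′)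
  ·-monoˡ-⊑ (p , q , r) {a , b , c} (≤₃ c≤c′) = ≤₃ (+-monoˡ-≤ (p * b) (+-monoʳ-≤ r c≤c′))

  ·-monoʳ-⊑ : ∀ z {x y} → x ⊑ y → x · z ⊑ y · z
  ·-monoʳ-⊑ (p , q , r) (<₁ a<a′) = <₁ (+-monoˡ-< p a<a′)
  ·-monoʳ-⊑ (p , q , r) (<₂ b<b′) = <₂ (+-monoˡ-< q b<b′)
  ·-monoʳ-⊑ (p , q , r) {a , b , c} (≤₃ c≤c′) = ≤₃ (+-monoˡ-≤ (a * q) (+-monoˡ-≤ r c≤c′))

  HeisAlg : Alg
  HeisAlg = record
    { Carrier = Heis ; _≈_ = _≡_ ; isEquivalence = isEquivalence
    ; _∧_ = _⊓_ ; _∨_ = _⊔_ ; _·_ = _·_ ; ˡ = _⁻¹ ; ʳ = _⁻¹ ; e = ε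
    ; ∧-cong = cong₂ _⊓_ ; ∨-cong = cong₂ _⊔_ ; ·-cong = cong₂ _·_
    ; ˡ-cong = cong _⁻¹ ; ʳ-cong = cong _⁻¹ }

  isLPregroup : IsLPregroup HeisAlg
  isLPregroup = record
    { isLattice = ⊔-⊓-isLattice
    ; isMonoid  = record
      { isSemigroup = record
        { isMagma = record { isEquivalence = isEquivalence ; ∙-cong = cong₂ _·_ }
        ; assoc   = ·-assoc }
      ; identity = ·-identityˡ , ·-identityʳ }
    ; ·-monoˡ = λ z → x≤y⇒x⊓y≈x ∘ ·-monoˡ-⊑ z ∘ x⊓y≈x⇒x≤y
    ; ·-monoʳ = λ z → x≤y⇒x⊓y≈x ∘ ·-monoʳ-⊑ z ∘ x⊓y≈x⇒x≤y
    ; ˡ-contr = λ x → ≡⇒⊓≡ (·-inverseˡ x)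
    ; ˡ-exp   = λ x → ≡⇒⊓≡ (sym (·-inverseʳ x))
    ; ʳ-contr = λ x → ≡⇒⊓≡ (·-inverseʳ x)
    ; ʳ-exp   = λ x → ≡⇒⊓≡ (sym (·-inverseˡ x)) }
    where
    ≡⇒⊓≡ : ∀ {x y} → x ≡ y → x ⊓ y ≡ x
    ≡⇒⊓≡ refl = x≤y⇒x⊓y≈x ⊑-refl

  ∈LP : ∀ n → InLP n HeisAlg
  ∈LP n = isLPregroup , λ _ → refl

  ⊭⋁lft²-comm : ∀ m → ¬ Satisfies HeisAlg (⋁lft²-product m 0 1) (⋁lft²-product m 1 0)
  ⊭⋁lft²-comm m sat = x·y≢y·x (begin
    x · y                                  ≡⟨ cong₂ _·_ (u≡ 0) (u≡ 1) ⟨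
    ⟦ ⋁lft²-product m 0 1 ⟧ v              ≡⟨ sat v ⟩
    ⟦ ⋁lft²-product m 1 0 ⟧ v              ≡⟨ cong₂ _·_ (u≡ 1) (u≡ 0) ⟩
    y · x                                  ∎)
    where
    open ≡-Reasoning
    open Alg HeisAlg using (⟦_⟧)
    x y : Heis
    x = (1ℤ , 0ℤ , 0ℤ)
    y = (0ℤ , 1ℤ , 0ℤ)
    v : ℕ → Heis
    v 0 = x
    v 1 = y
    v _ = ε
    u≡ : ∀ i → ⟦ ⋁lft² m (var i) ⟧ v ≡ v i
    u≡ i = ⟦⋁lft²⟧ HeisAlg ⁻¹-involutive ⊔-idem m (var i) v
    x·y≢y·x : x · y ≢ y · x
    x·y≢y·x ()

open import Data.Nat using (_≤_)

corollary3p11 : (n : ℕ) → 1 ≤ n → ¬ (∀ (A : Alg) → (InLP n A ⇔ InV n A))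
corollary3p11 zero    ()  _
corollary3p11 (suc m) _   LP⇔V = Heisenberg.⊭⋁lft²-comm m Heis⊨⋁lft²-comm
  where
  Heis⊨⋁lft²-comm : Satisfies Heisenberg.HeisAlg (⋁lft²-product m 0 1) (⋁lft²-product m 1 0)
  Heis⊨⋁lft²-comm = Equivalence.to (LP⇔V Heisenberg.HeisAlg) (Heisenberg.∈LP (suc m))
    (⋁lft²-product m 0 1) (⋁lft²-product m 1 0) (Fₙ-Identity.Fₙ⊨⋁lft²-comm m)
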